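{- Let $G$ be a chordal graph with a tree representation $(T_0,\mathcal F)$, $\mathcal F=\{F_v: v\in V(G)\}$, in which $T_0$ has the minimum possible number of vertices, and let $I$ be an independent set of $G$ chosen as described in the context. Then for every vertex $v$ of $G$, the tree $F_v$ contains a substantial vertex.
   Context: A tree representation of a graph $G$ is a tree $T_0$ together with a family $\mathcal F=\{F_v : v\in V(G)\}$ of subtrees of $T_0$ such that for distinct $u,v$, $uv\in E(G)$ iff $F_u$ and $F_v$ share a vertex; every chordal graph has one. Fix such a representation with $|V(T_0)|$ minimum. Choose an independent set $I$ of $G$ that is maximal with the property that for each $v\in I$, $F_v$ is a path all of whose vertices have degree at most $2$ in $T_0$; moreover $I$ is chosen such that for every $v\in I$, $F_v$ contains no member of $\mathcal F$ as a proper subgraph. For $v\in I$, $F_v$ is called an $I$-path (trivial if it has a single vertex, which is then its endvertex). A vertex of $T_0$ is substantial if it is an endvertex of some $I$-path or has degree at least $3$ in $T_0$. -}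

module Defs where

open import Data.Nat using (ℕ; zero; suc; _+_; _≤_)
open import Data.Fin using (Fin)
open import Data.Bool using (Bool; true; false; _∧_; if_then_else_)
open import Data.List using (List; []; _∷_; _++_; length; map; allFin)
open import Data.Nat.ListAction using (sum)
open import Data.Sum using (_⊎_)
open import Data.List.Membership.Propositional using (_∈_)
open import Data.List.Relation.Unary.Linked using (Linked)
open import Data.List.Relation.Unary.Unique.Propositional using (Unique)
open import Data.Product using (Σ; ∃; _×_; _,_)
open import Data.Empty using (⊥)
open import Relation.Nullary using (¬_)
open import Relation.Binary.PropositionalEquality using (_≡_; _≢_)
open import Function.Bundles using (_⇔_)

record Graph (n : ℕ) : Set where
  field
    adj   : Fin n → Fin n → Bool
    sym   : ∀ x y → adj x y ≡ adj y x
    irrefl : ∀ x → adj x x ≡ false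
open Graph public

VSet : ℕ → Set
VSet m = Fin m → Bool

_⊆ᵛ_ : ∀ {m} → VSet m → VSet m → Set
S ⊆ᵛ S' = ∀ x → S x ≡ true → S' x ≡ true

degIn : ∀ {m} → Graph m → VSet m → Fin m → ℕ
degIn {m} T S x = sum (map (λ y → if adj T x y ∧ S y then 1 else 0) (allFin m))

deg : ∀ {m} → Graph m → Fin m → ℕ
deg T x = degIn T (λ _ → true) x

data WalkIn {m} (T : Graph m) (S : VSet m) : Fin m → Fin m → Set where
  here : ∀ {x} → S x ≡ true → WalkIn T S x x
  step : ∀ {x y z} → S x ≡ true → adj T x y ≡ true → WalkIn T S y z → WalkIn T S x z

Chain : ∀ {m} → Graph m → List (Fin m) → Set
Chain T = Linked (λ x y → adj T x y ≡ true)

HasCycle : ∀ {m} → Graph m → Set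
HasCycle {m} T = Σ (Fin m) λ x → Σ (List (Fin m)) λ ys →
  (2 ≤ length ys) × Unique (x ∷ ys) × Chain T (x ∷ ys ++ x ∷ [])

Connected : ∀ {m} → Graph m → Set
Connected {m} T = ∀ (x y : Fin m) → WalkIn T (λ _ → true) x y

IsTree : ∀ {m} → Graph m → Set
IsTree T = Connected T × ¬ HasCycle T

-- a subtree of the tree T: nonempty vertex set inducing a connected subgraph
-- (in a tree, subtrees are exactly the subgraphs induced by such sets)
IsSubtree : ∀ {m} → Graph m → VSet m → Set
IsSubtree {m} T S =
  (Σ (Fin m) λ x → S x ≡ true) ×
  (∀ x y → S x ≡ true → S y ≡ true → WalkIn T S x y)

IsPathSet : ∀ {m} → Graph m → VSet m → Set
IsPathSet {m} T S = Σ (List (Fin m)) λ xs →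
  Unique xs × Chain T xs × (∀ y → (S y ≡ true ⇔ y ∈ xs))

Meet : ∀ {m} → VSet m → VSet m → Set
Meet {m} S S' = Σ (Fin m) λ x → (S x ≡ true) × (S' x ≡ true)

record TreeRep {n : ℕ} (G : Graph n) : Set where
  field
    m       : ℕ
    T₀      : Graph m
    isTree  : IsTree T₀
    F       : Fin n → VSet m
    subtree : ∀ v → IsSubtree T₀ (F v)
    rep     : ∀ u v → u ≢ v → (adj G u v ≡ true ⇔ Meet (F u) (F v))
open TreeRep public

MinimumRep : ∀ {n} (G : Graph n) → TreeRep G → Set
MinimumRep G R = ∀ (R' : TreeRep G) → m R ≤ m R'

module _ {n : ℕ} {G : Graph n} (R : TreeRep G) where

  Independent : VSet n → Set
  Independent J = ∀ u v → J u ≡ true → J v ≡ true → adj G u v ≡ false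

  PathProp : Fin n → Set
  PathProp v = IsPathSet (T₀ R) (F R v) × (∀ x → F R v x ≡ true → deg (T₀ R) x ≤ 2)

  AllPathProp : VSet n → Set
  AllPathProp J = ∀ v → J v ≡ true → PathProp v

  NoProperSub : Fin n → Set
  NoProperSub v = ∀ u → F R u ⊆ᵛ F R v → F R v ⊆ᵛ F R u

  ChosenI : VSet n → Set
  ChosenI I =
    Independent I × AllPathProp I ×
    (∀ J → I ⊆ᵛ J → Independent J → AllPathProp J → J ⊆ᵛ I) ×
    (∀ v → I v ≡ true → NoProperSub v)

  -- x is an endvertex of the I-path F_v (v ∈ I): a vertex of F_v with at
  -- most one neighbour in F_v (the unique vertex, if F_v is trivial)
  Endvertex : Fin n → Fin (m R) → Set
  Endvertex v x = (F R v x ≡ true) × (degIn (T₀ R) (F R v) x ≤ 1)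

  Substantial : VSet n → Fin (m R) → Set
  Substantial I x =
    (Σ (Fin n) λ v → (I v ≡ true) × Endvertex v x) ⊎ (3 ≤ deg (T₀ R) x)

-- If F_v contains a vertex of degree ≥ 3 we are done.  If F_v meets an I-path
-- F_u, then either F_v leaves F_u, and the vertex of F_u where it leaves has a
-- neighbour outside F_u, so (having degree ≤ 2) it is an endvertex of F_u; or
-- F_v ⊆ F_u, hence F_u = F_v as F_u contains no smaller member of 𝓕, and the
-- endvertices of F_u lie in F_v.  Otherwise all vertices of F_v have degree
-- ≤ 2 and F_v misses every I-path; then F_v is a path, v can be added to I,
-- and maximality of I gives v ∈ I, so F_v meets the I-path F_v after all.
module Submission where

open import Defs hiding (sym)
open import Data.Nat using (ℕ; zero; suc; _+_; _≤_; _≤?_; z≤n; s≤s)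
open import Data.Nat.Properties
  using (≤-refl; ≤-trans; ≤-reflexive; ≤-antisym; ≤-pred; +-mono-≤; +-cancelʳ-≤; +-identityʳ; +-suc;
         m≤m+n; m≤n+m; n≤0⇒n≡0; n≮n; ≰⇒>; +-commutativeSemigroup; module ≤-Reasoning)
open import Algebra.Properties.CommutativeSemigroup +-commutativeSemigroup using (interchange)
open import Data.Fin using (Fin; _≟_)
open import Data.Fin.Properties using (any?)
open import Data.Bool using (Bool; true; false; _∧_; _∨_; if_then_else_)
open import Data.Bool.Properties using (∨-zeroʳ; ¬-not; not-¬) renaming (_≟_ to _≟ᵇ_)
open import Data.List using (List; []; _∷_; _++_; _∷ʳ_; length; map; allFin)
open import Data.List.Properties using (++-assoc; length-++; ∷-injectiveˡ; ∷ʳ-injectiveʳ)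
open import Data.Nat.ListAction using (sum)
open import Data.List.Membership.Propositional using (_∈_; _∉_)
open import Data.List.Membership.Propositional.Properties using (∈-allFin; ∈-∃++; ∈-++⁺ˡ)
open import Data.List.Relation.Unary.Any as Any using (here; there)
open import Data.List.Relation.Unary.All as All using (All; []; _∷_)
open import Data.List.Relation.Unary.All.Properties using (++⁻ˡ)
open import Data.List.Relation.Unary.All.Properties.Core using (¬Any⇒All¬; All¬⇒¬Any)
open import Data.List.Relation.Unary.AllPairs using ([]; _∷_)
open import Data.List.Relation.Unary.Linked using (Linked; []; [-]; _∷_)
open import Data.List.Relation.Unary.Unique.Propositional using (Unique)
open import Data.List.Relation.Unary.Unique.Propositional.Properties using (allFin⁺)
open import Data.Product using (Σ; _×_; _,_; proj₁; proj₂)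
open import Data.Sum using (_⊎_; inj₁; inj₂)
open import Data.Empty using (⊥-elim)
open import Function using (_∘_)
open import Function.Bundles using (mk⇔; Equivalence)
open import Relation.Nullary using (¬_; Dec; yes; no; does)
open import Relation.Nullary.Decidable using (_×-dec_; ¬?; decidable-stable)
open import Relation.Unary using (Decidable)
open import Relation.Binary.PropositionalEquality using (_≡_; _≢_; refl; sym; trans; cong; cong₂; subst)

-- Counting over the finite vertex set Fin m

module _ {m : ℕ} where

  _∈?_ : ∀ (x : Fin m) xs → Dec (x ∈ xs)
  x ∈? xs = Any.any? (x ≟_) xs

  δ : Fin m → Fin m → ℕ
  δ x y = if does (x ≟ y) then 1 else 0

  δ-refl : ∀ x → δ x x ≡ 1
  δ-refl x with x ≟ x
  ... | yes _  = refl
  ... | no x≢x = ⊥-elim (x≢x refl)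

  δ-≢ : ∀ {x y} → x ≢ y → δ x y ≡ 0
  δ-≢ {x} {y} x≢y with x ≟ y
  ... | yes x≡y = ⊥-elim (x≢y x≡y)
  ... | no _    = refl

  δ-sym : ∀ x y → δ x y ≡ δ y x
  δ-sym x y with x ≟ y | y ≟ x
  ... | yes _   | yes _   = refl
  ... | no _    | no _    = refl
  ... | yes x≡y | no y≢x  = ⊥-elim (y≢x (sym x≡y))
  ... | no x≢y  | yes y≡x = ⊥-elim (x≢y (sym y≡x))

  occ : List (Fin m) → Fin m → ℕ
  occ []      y = 0
  occ (k ∷ K) y = δ k y + occ K y

  occ-∉ : ∀ {K y} → y ∉ K → occ K y ≡ 0
  occ-∉ {[]}    y∉ = refl
  occ-∉ {k ∷ K} y∉ = cong₂ _+_ (δ-≢ (λ k≡y → y∉ (here (sym k≡y)))) (occ-∉ (y∉ ∘ there))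

  occ-∈ : ∀ {K y} → y ∈ K → 1 ≤ occ K y
  occ-∈ {k ∷ K} (here refl) = ≤-trans (≤-reflexive (sym (δ-refl k))) (m≤m+n _ _)
  occ-∈ {k ∷ K} (there y∈)  = ≤-trans (occ-∈ y∈) (m≤n+m _ _)

  occ-unique : ∀ {K} y → Unique K → occ K y ≤ 1
  occ-unique {[]}    y _ = z≤n
  occ-unique {k ∷ K} y (k∉ ∷ u) with k ≟ y
  ... | yes refl = ≤-reflexive (cong suc (occ-∉ {K} {k} (All¬⇒¬Any k∉)))
  ... | no _     = occ-unique y u

  total : (Fin m → ℕ) → ℕ
  total f = sum (map f (allFin m))

  total-mono : ∀ {f g} → (∀ y → f y ≤ g y) → total f ≤ total g
  total-mono {f} {g} f≤g = go (allFin m)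
    where
      go : ∀ L → sum (map f L) ≤ sum (map g L)
      go []      = z≤n
      go (y ∷ L) = +-mono-≤ (f≤g y) (go L)

  total-+ : ∀ f g → total (λ y → f y + g y) ≡ total f + total g
  total-+ f g = go (allFin m)
    where
      go : ∀ L → sum (map (λ y → f y + g y) L) ≡ sum (map f L) + sum (map g L)
      go []      = refl
      go (y ∷ L) = trans (cong (f y + g y +_) (go L)) (interchange (f y) (g y) _ _)

  -- every vertex occurs exactly once in the enumeration of all vertices
  total-δ : ∀ c → total (δ c) ≡ 1
  total-δ c = ≤-antisym (≤-trans (≤-reflexive (δ-sum (allFin m))) (occ-unique c (allFin⁺ m)))
                        (≤-trans (occ-∈ (∈-allFin c)) (≤-reflexive (sym (δ-sum (allFin m)))))
    where
      δ-sum : ∀ L → sum (map (δ c) L) ≡ occ L c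
      δ-sum []      = refl
      δ-sum (y ∷ L) = cong₂ _+_ (δ-sym c y) (δ-sum L)

  total-occ : ∀ K → total (occ K) ≡ length K
  total-occ []      = n≤0⇒n≡0 (zeros (allFin m))
    where
      zeros : ∀ L → sum (map (λ _ → 0) L) ≤ 0
      zeros []      = z≤n
      zeros (_ ∷ L) = zeros L
  total-occ (k ∷ K) = trans (total-+ (δ k) (occ K)) (cong₂ _+_ (total-δ k) (total-occ K))

  total≤length : ∀ {f} K → (∀ y → f y ≤ occ K y) → total f ≤ length K
  total≤length K f≤occ = ≤-trans (total-mono f≤occ) (≤-reflexive (total-occ K))

  length≤total : ∀ {f} K → Unique K → (∀ k → k ∈ K → 1 ≤ f k) → length K ≤ total f
  length≤total {f} K u pos = ≤-trans (≤-reflexive (sym (total-occ K))) (total-mono occ≤f)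
    where
      occ≤f : ∀ y → occ K y ≤ f y
      occ≤f y with y ∈? K
      ... | yes y∈ = ≤-trans (occ-unique y u) (pos y y∈)
      ... | no y∉  = ≤-trans (≤-reflexive (occ-∉ y∉)) z≤n

-- Degrees and walks in a graph T

module _ {m : ℕ} (T : Graph m) where

  degIn≤1 : ∀ S x c → (∀ y → adj T x y ≡ true → S y ≡ true → y ≡ c) → degIn T S x ≤ 1
  degIn≤1 S x c only-c = total≤length (c ∷ []) bound
    where
      bound : ∀ y → (if adj T x y ∧ S y then 1 else 0) ≤ occ (c ∷ []) y
      bound y with adj T x y in xy | S y in Sy
      ... | false | _     = z≤n
      ... | true  | false = z≤n
      ... | true  | true  with only-c y xy Sy
      ...   | refl = ≤-trans (≤-reflexive (sym (δ-refl c))) (m≤m+n _ _)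

  -- a neighbour b of a outside S is counted by deg but not by degIn S
  degIn<deg : ∀ S a b → adj T a b ≡ true → S b ≡ false → degIn T S a + 1 ≤ deg T a
  degIn<deg S a b ab Sb = begin
    degIn T S a + 1                        ≡⟨ cong (degIn T S a +_) (sym (total-δ b)) ⟩
    degIn T S a + total (δ b)              ≡⟨ sym (total-+ inS (δ b)) ⟩
    total (λ y → inS y + δ b y)            ≤⟨ total-mono bound ⟩
    deg T a                                ∎
    where
      open ≤-Reasoning
      inS : Fin m → ℕ
      inS y = if adj T a y ∧ S y then 1 else 0
      bound : ∀ y → inS y + δ b y ≤ (if adj T a y ∧ true then 1 else 0)
      bound y with y ≟ b
      ... | yes refl rewrite ab | Sb | δ-refl y = ≤-refl
      ... | no y≢b rewrite δ-≢ (y≢b ∘ sym) with adj T a y | S y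
      ...   | false | _     = z≤n
      ...   | true  | true  = ≤-refl
      ...   | true  | false = z≤n

  deg≥3 : ∀ a p q b → p ≢ q → p ≢ b → q ≢ b →
          adj T a p ≡ true → adj T a q ≡ true → adj T a b ≡ true → 3 ≤ deg T a
  deg≥3 a p q b p≢q p≢b q≢b ap aq ab =
    length≤total (p ∷ q ∷ b ∷ []) ((p≢q ∷ p≢b ∷ []) ∷ (q≢b ∷ []) ∷ [] ∷ []) neighbour
    where
      neighbour : ∀ k → k ∈ p ∷ q ∷ b ∷ [] → 1 ≤ (if adj T a k ∧ true then 1 else 0)
      neighbour k (here refl)                 rewrite ap = ≤-refl
      neighbour k (there (here refl))         rewrite aq = ≤-refl
      neighbour k (there (there (here refl))) rewrite ab = ≤-refl

  walk-exit : ∀ {P : VSet m} (Q : Fin m → Set) → Decidable Q → ∀ {x y} →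
              WalkIn T P x y → Q x → ¬ Q y →
              Σ (Fin m) λ a → Σ (Fin m) λ b →
                P a ≡ true × Q a × P b ≡ true × ¬ Q b × adj T a b ≡ true
  walk-exit Q Q? (here _) Qx ¬Qy = ⊥-elim (¬Qy Qx)
  walk-exit Q Q? (step {x} {z} Px xz walk) Qx ¬Qy with Q? z
  ... | yes Qz = walk-exit Q Q? walk Qz ¬Qy
  ... | no ¬Qz = x , z , Px , Qx , start walk , ¬Qz , xz
    where
      start : ∀ {P : VSet m} {u w} → WalkIn T P u w → P u ≡ true
      start (here Pu)     = Pu
      start (step Pu _ _) = Pu

module _ {A : Set} where

  unique-prefix : ∀ pre {y : A} {post} → Unique (pre ++ y ∷ post) → Unique (pre ++ y ∷ [])
  unique-prefix []        (_ ∷ _)    = [] ∷ []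
  unique-prefix (a ∷ pre) {y} {post} (a∉ ∷ u) =
    ++⁻ˡ (pre ++ y ∷ []) (subst (All (a ≢_)) (sym (++-assoc pre (y ∷ []) post)) a∉) ∷ unique-prefix pre u

  chain-close : ∀ {R : A → A → Set} pre {y z : A} {post} →
                Linked R (pre ++ y ∷ post) → R y z → Linked R ((pre ++ y ∷ []) ++ z ∷ [])
  chain-close []              _          yz = yz ∷ [-]
  chain-close (a ∷ [])        (ay ∷ _)   yz = ay ∷ yz ∷ [-]
  chain-close (a ∷ a′ ∷ pre)  (aa′ ∷ c)  yz = aa′ ∷ chain-close (a′ ∷ pre) c yz

  last-link : ∀ {R : A → A → Set} pre {h : A} → Linked R (pre ++ h ∷ []) →
              pre ≡ [] ⊎ Σ A λ p → p ∈ pre × R p h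
  last-link []             _        = inj₁ refl
  last-link (a ∷ [])       (ah ∷ _) = inj₂ (a , here refl , ah)
  last-link (a ∷ a′ ∷ pre) (_ ∷ c) with last-link (a′ ∷ pre) c
  ... | inj₂ (p , p∈ , ph) = inj₂ (p , there p∈ , ph)

-- Simple chains in an acyclic graph

module Chains {m : ℕ} (T : Graph m) (acyclic : ¬ HasCycle T) where

  adj-sym : ∀ {x y} → adj T x y ≡ true → adj T y x ≡ true
  adj-sym {x} {y} xy = trans (Graph.sym T y x) xy

  loopless : ∀ {x} → adj T x x ≢ true
  loopless {x} xx with trans (sym xx) (Graph.irrefl T x)
  ... | ()

  -- the successor of x on the chain x ∷ xs (x itself if there is none)
  next : Fin m → List (Fin m) → Fin m
  next x []      = x
  next _ (y ∷ _) = y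

  -- the first vertex of a simple chain is adjacent to no later vertex of the
  -- chain but its successor: a later one would close a cycle
  first-neighbour : ∀ x xs {y} → Unique (x ∷ xs) → Chain T (x ∷ xs) →
                    y ∈ x ∷ xs → adj T x y ≡ true → y ≡ next x xs
  first-neighbour x xs       _ _ (here refl)         xx = ⊥-elim (loopless xx)
  first-neighbour x (r ∷ rs) _ _ (there (here refl)) _  = refl
  first-neighbour x (r ∷ rs) u c (there (there y∈))  xy with ∈-∃++ y∈
  ... | pre , post , refl = ⊥-elim (acyclic (x , r ∷ pre ++ _ ∷ [] , two , unique-prefix (x ∷ r ∷ pre) u ,
                                             chain-close (x ∷ r ∷ pre) c (adj-sym xy)))
    where
      two : 2 ≤ length (r ∷ pre ++ _ ∷ [])
      two = s≤s (≤-trans (m≤n+m 1 (length pre)) (≤-reflexive (sym (length-++ pre))))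

  -- hence a path has an endvertex: its first vertex
  path-endvertex : ∀ {S} → IsPathSet T S → (Σ (Fin m) λ x → S x ≡ true) →
                   Σ (Fin m) λ x → S x ≡ true × degIn T S x ≤ 1
  path-endvertex ([] , _ , _ , S⇔xs) (x , Sx) with Equivalence.to (S⇔xs x) Sx
  ... | ()
  path-endvertex {S} (x ∷ xs , u , c , S⇔xs) _ =
    x , Equivalence.from (S⇔xs x) (here refl) , degIn≤1 T S x (next x xs) successor
    where
      successor : ∀ y → adj T x y ≡ true → S y ≡ true → y ≡ next x xs
      successor y xy Sy = first-neighbour x xs u c (Equivalence.to (S⇔xs y) Sy) xy

  data Position (xs : List (Fin m)) (a : Fin m) : Set where
    first : ∀ {ys} → xs ≡ a ∷ ys → Position xs a
    last  : ∀ {ys} → xs ≡ ys ∷ʳ a → Position xs a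
    inner : ∀ {p q} → p ∈ xs → q ∈ xs → p ≢ q → adj T a p ≡ true → adj T a q ≡ true →
            Position xs a

  second-position : ∀ x y ys → Unique (x ∷ y ∷ ys) → Chain T (x ∷ y ∷ ys) → Position (x ∷ y ∷ ys) y
  second-position x y []       _        _             = last {ys = x ∷ []} refl
  second-position x y (z ∷ zs) (x∉ ∷ _) (xy ∷ yz ∷ _) =
    inner (here refl) (there (there (here refl))) (All.head (All.tail x∉)) (adj-sym xy) yz

  position : ∀ xs {a} → Unique xs → Chain T xs → a ∈ xs → Position xs a
  position (x ∷ xs)     _        _        (here refl) = first refl
  position (x ∷ y ∷ ys) (x∉ ∷ u) (xy ∷ c) (there a∈) with position (y ∷ ys) u c a∈
  ... | first refl          = second-position x y ys (x∉ ∷ u) (xy ∷ c)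
  ... | last {ys} e         = last {ys = x ∷ ys} (cong (x ∷_) e)
  ... | inner p∈ q∈ p≢q ap aq = inner (there p∈) (there q∈) p≢q ap aq

  module Growing (S : VSet m) where

    SimpleIn : List (Fin m) → Set
    SimpleIn xs = Unique xs × Chain T xs × All (λ y → S y ≡ true) xs

    ClosedAt : Fin m → List (Fin m) → Set
    ClosedAt x xs = ∀ b → S b ≡ true → adj T x b ≡ true → b ∈ xs

    singleton : ∀ {x} → S x ≡ true → SimpleIn (x ∷ [])
    singleton Sx = [] ∷ [] , [-] , Sx ∷ []

    grow : ∀ {x xs b} → SimpleIn (x ∷ xs) → S b ≡ true → adj T x b ≡ true → b ∉ x ∷ xs →
           SimpleIn (b ∷ x ∷ xs)
    grow (u , c , inS) Sb xb b∉ = ¬Any⇒All¬ _ b∉ ∷ u , adj-sym xb ∷ c , Sb ∷ inS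

    record Extension (xs : List (Fin m)) : Set where
      constructor extension
      field
        prefix : List (Fin m)
        front  : Fin m
        rest   : List (Fin m)
        shape  : front ∷ rest ≡ prefix ++ xs
        simple : SimpleIn (front ∷ rest)
        closed : ClosedAt front (front ∷ rest)
    open Extension public

    N : ℕ
    N = total {m} (λ _ → 1)

    -- keep adding an S-neighbour of the first vertex not yet on the chain; the
    -- fuel bounds the number of steps, since a simple chain has at most N vertices
    extend : ∀ fuel x xs → SimpleIn (x ∷ xs) → N ≤ length (x ∷ xs) + fuel → Extension (x ∷ xs)
    extend fuel x xs p bound
      with any? (λ b → (S b ≟ᵇ true) ×-dec (adj T x b ≟ᵇ true) ×-dec ¬? (b ∈? (x ∷ xs)))
    ... | no stuck = extension [] x xs refl p x-closed
      where
        x-closed : ClosedAt x (x ∷ xs)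
        x-closed b Sb xb = decidable-stable (b ∈? (x ∷ xs)) (λ b∉ → stuck (b , Sb , xb , b∉))
    ... | yes (b , Sb , xb , b∉) with fuel
    ...   | zero = ⊥-elim (n≮n _ (≤-trans (length≤total _ (proj₁ (grow p Sb xb b∉)) (λ _ _ → ≤-refl))
                                          (≤-trans bound (≤-reflexive (+-identityʳ _)))))
    ...   | suc fuel′
      with extend fuel′ b (x ∷ xs) (grow p Sb xb b∉) (≤-trans bound (≤-reflexive (+-suc _ fuel′)))
    ...     | extension pre f r shapeᵇ simpleᵇ closedᵇ =
              extension (pre ++ b ∷ []) f r (trans shapeᵇ (sym (++-assoc pre (b ∷ []) (x ∷ xs))))
                        simpleᵇ closedᵇ

    -- Let h₁ ∷ t₁ be closed at h₁ and regrow a chain in front of h₁ alone.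
    -- Then h₁, now the last vertex, is still closed: by acyclicity its only
    -- S-neighbour is its successor on h₁ ∷ t₁, which is also the vertex
    -- preceding h₁ on the new chain (or h₁ is the closed first vertex)
    still-closed : ∀ h₁ t₁ → SimpleIn (h₁ ∷ t₁) → ClosedAt h₁ (h₁ ∷ t₁) →
                   (E : Extension (h₁ ∷ [])) → ClosedAt h₁ (front E ∷ rest E)
    still-closed h₁ t₁ (u₁ , c₁ , _) closed₁ E b Sb h₁b
      with last-link (prefix E) (subst (Chain T) (shape E) (proj₁ (proj₂ (simple E))))
    ... | inj₁ refl with shape E
    ...   | refl = closed E b Sb h₁b
    still-closed h₁ t₁ (u₁ , c₁ , _) closed₁ E b Sb h₁b | inj₂ (p , p∈ , ph₁) =
      subst (_∈ front E ∷ rest E) (trans (successor p Sp (adj-sym ph₁)) (sym (successor b Sb h₁b))) p∈E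
      where
        successor : ∀ y → S y ≡ true → adj T h₁ y ≡ true → y ≡ next h₁ t₁
        successor y Sy h₁y = first-neighbour h₁ t₁ u₁ c₁ (closed₁ y Sy h₁y) h₁y
        p∈E : p ∈ front E ∷ rest E
        p∈E = subst (p ∈_) (sym (shape E)) (∈-++⁺ˡ p∈)
        Sp : S p ≡ true
        Sp = All.lookup (proj₂ (proj₂ (simple E))) p∈E

    -- no edge inside S leaves a simple chain in S that is closed at both ends
    -- and runs through vertices of degree ≤ 2: an inner vertex already has
    -- two neighbours on the chain
    no-exit : (∀ x → S x ≡ true → deg T x ≤ 2) →
              ∀ {h t ini l} → SimpleIn (h ∷ t) → h ∷ t ≡ ini ∷ʳ l →
              ClosedAt h (h ∷ t) → ClosedAt l (h ∷ t) →
              ∀ a b → a ∈ h ∷ t → S b ≡ true → adj T a b ≡ true → b ∈ h ∷ t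
    no-exit deg≤2 {h} {t} {ini} (u , c , inS) ends closedₕ closedₗ a b a∈ Sb ab
      with position (h ∷ t) u c a∈
    ... | first e     = subst (λ z → ClosedAt z (h ∷ t)) (∷-injectiveˡ e) closedₕ b Sb ab
    ... | last {ys} e = subst (λ z → ClosedAt z (h ∷ t)) (∷ʳ-injectiveʳ ini ys (trans (sym ends) e))
                              closedₗ b Sb ab
    ... | inner p∈ q∈ p≢q ap aq with b ∈? (h ∷ t)
    ...   | yes b∈ = b∈
    ...   | no b∉  = ⊥-elim (n≮n 2 (≤-trans (deg≥3 T a _ _ b p≢q (off p∈) (off q∈) ap aq ab)
                                            (deg≤2 a (All.lookup inS a∈))))
      where
        off : ∀ {z} → z ∈ h ∷ t → z ≢ b
        off z∈ refl = b∉ z∈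

  -- a subtree all of whose vertices have degree ≤ 2 is a path: grow a chain
  -- from one of its vertices until its first vertex h₁ is closed, regrow from
  -- h₁ to close the other end, and observe that no edge inside S leaves it
  path-of-degree≤2 : ∀ {S} → IsSubtree T S → (∀ x → S x ≡ true → deg T x ≤ 2) → IsPathSet T S
  path-of-degree≤2 {S} ((x₀ , Sx₀) , connected) deg≤2 =
    M , proj₁ (simple E₂) , proj₁ (proj₂ (simple E₂)) ,
    λ y → mk⇔ (covers y) (All.lookup (proj₂ (proj₂ (simple E₂))))
    where
      open Growing S
      E₁ : Extension (x₀ ∷ [])
      E₁ = extend N x₀ [] (singleton Sx₀) (m≤n+m N 1)
      E₂ : Extension (front E₁ ∷ [])
      E₂ = extend N (front E₁) [] (singleton (All.head (proj₂ (proj₂ (simple E₁))))) (m≤n+m N 1)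
      M : List (Fin m)
      M = front E₂ ∷ rest E₂
      closed-ends : ∀ a b → a ∈ M → S b ≡ true → adj T a b ≡ true → b ∈ M
      closed-ends = no-exit deg≤2 (simple E₂) (shape E₂) (closed E₂)
                      (still-closed (front E₁) (rest E₁) (simple E₁) (closed E₁) E₂)
      covers : ∀ y → S y ≡ true → y ∈ M
      covers y Sy = decidable-stable (y ∈? M) λ y∉ →
        let walk = connected (front E₂) y (All.head (proj₂ (proj₂ (simple E₂)))) Sy
            (a , b , _ , a∈ , Sb , b∉ , ab) = walk-exit T (_∈ M) (_∈? M) walk (here refl) y∉
        in b∉ (closed-ends a b a∈ Sb ab)

-- Tree representations and the chosen set I

meet? : ∀ {k} (S S′ : VSet k) → Dec (Meet S S′)
meet? S S′ = any? (λ x → (S x ≟ᵇ true) ×-dec (S′ x ≟ᵇ true))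

module _ {n : ℕ} {G : Graph n} (R : TreeRep G) (I : VSet n) (chosen : ChosenI R I) where

  open Chains (T₀ R) (proj₂ (isTree R))

  private
    independent : Independent R I
    independent = proj₁ chosen
    I-paths : AllPathProp R I
    I-paths = proj₁ (proj₂ chosen)
    maximal : ∀ J → I ⊆ᵛ J → Independent R J → AllPathProp R J → J ⊆ᵛ I
    maximal = proj₁ (proj₂ (proj₂ chosen))
    minimal : ∀ u → I u ≡ true → NoProperSub R u
    minimal = proj₂ (proj₂ (proj₂ chosen))

  I-endvertex : ∀ {u} → I u ≡ true → Σ (Fin (m R)) λ x → F R u x ≡ true × Endvertex R u x
  I-endvertex {u} Iu with path-endvertex (proj₁ (I-paths u Iu)) (proj₁ (subtree R u))
  ... | x , ux , end = x , ux , ux , end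

  -- a subtree meeting an I-path F_u contains an endvertex of F_u: either the
  -- vertex where F_v leaves F_u (it has degree ≤ 2 and a neighbour outside
  -- F_u), or, if F_v ⊆ F_u, any endvertex of F_u, since then F_u ⊆ F_v
  meeting-I-path : ∀ {u v} → I u ≡ true → Meet (F R u) (F R v) →
                   Σ (Fin (m R)) λ x → F R v x ≡ true × Substantial R I x
  meeting-I-path {u} {v} Iu (x , ux , vx) with any? (λ y → (F R v y ≟ᵇ true) ×-dec (F R u y ≟ᵇ false))
  ... | yes (y , vy , uy) =
    let (a , b , va , ua , _ , ¬ub , ab) =
          walk-exit (T₀ R) (λ z → F R u z ≡ true) (λ z → F R u z ≟ᵇ true)
                    (proj₂ (subtree R v) x y vx vy) ux (not-¬ uy)
        a-end = +-cancelʳ-≤ 1 _ 1 (≤-trans (degIn<deg (T₀ R) (F R u) a b ab (¬-not ¬ub))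
                                           (proj₂ (I-paths u Iu) a ua))
    in a , va , inj₁ (u , Iu , ua , a-end)
  ... | no inside =
    let (e , ue , end) = I-endvertex Iu
    in e , minimal u Iu v v⊆u e ue , inj₁ (u , Iu , end)
    where
      v⊆u : F R v ⊆ᵛ F R u
      v⊆u y vy = decidable-stable (F R u y ≟ᵇ true) (λ ¬uy → inside (y , vy , ¬-not ¬uy))

  -- a vertex whose subtree has only vertices of degree ≤ 2 and meets no
  -- I-path could be added to I, so by maximality it already lies in I
  joins-I : ∀ v → (∀ x → F R v x ≡ true → deg (T₀ R) x ≤ 2) →
            (∀ u → I u ≡ true → ¬ Meet (F R u) (F R v)) → I v ≡ true
  joins-I v deg≤2 apart = maximal J I⊆J independent-J paths-J v J-v
    where
      J : VSet n
      J w = I w ∨ does (w ≟ v)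

      I⊆J : I ⊆ᵛ J
      I⊆J w Iw rewrite Iw = refl

      J-v : J v ≡ true
      J-v with v ≟ v
      ... | yes _  = ∨-zeroʳ (I v)
      ... | no v≢v = ⊥-elim (v≢v refl)

      in-J : ∀ {w} → J w ≡ true → I w ≡ true ⊎ w ≡ v
      in-J {w} Jw with I w | w ≟ v
      ... | true  | _        = inj₁ refl
      ... | false | yes refl = inj₂ refl

      not-adjacent : ∀ {u} → I u ≡ true → adj G u v ≡ false
      not-adjacent {u} Iu with u ≟ v
      ... | yes refl = Graph.irrefl G u
      ... | no u≢v with adj G u v in uv
      ...   | false = refl
      ...   | true  = ⊥-elim (apart u Iu (Equivalence.to (rep R u v u≢v) uv))

      independent-J : Independent R J
      independent-J u w Ju Jw with in-J Ju | in-J Jw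
      ... | inj₁ Iu   | inj₁ Iw   = independent u w Iu Iw
      ... | inj₁ Iu   | inj₂ refl = not-adjacent Iu
      ... | inj₂ refl | inj₁ Iw   = trans (Graph.sym G v w) (not-adjacent Iw)
      ... | inj₂ refl | inj₂ refl = Graph.irrefl G v

      paths-J : AllPathProp R J
      paths-J w Jw with in-J Jw
      ... | inj₁ Iw   = I-paths w Iw
      ... | inj₂ refl = path-of-degree≤2 (subtree R v) deg≤2 , deg≤2

proposition2p1 : ∀ {n} (G : Graph n) (R : TreeRep G) → MinimumRep G R →
    (I : Fin n → Bool) → ChosenI R I →
    ∀ (v : Fin n) → Σ (Fin (m R)) λ x → (F R v x ≡ true) × Substantial R I x
proposition2p1 G R _ I chosen v with any? (λ x → (F R v x ≟ᵇ true) ×-dec (3 ≤? deg (T₀ R) x))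
... | yes (x , vx , branching) = x , vx , inj₂ branching
... | no no-branching with any? (λ u → (I u ≟ᵇ true) ×-dec meet? (F R u) (F R v))
...   | yes (u , Iu , meets) = meeting-I-path R I chosen Iu meets
...   | no apart = ⊥-elim (apart (v , v∈I , x₀ , vx₀ , vx₀))
  where
    deg≤2 : ∀ x → F R v x ≡ true → deg (T₀ R) x ≤ 2
    deg≤2 x vx = ≤-pred (≰⇒> (λ branching → no-branching (x , vx , branching)))
    v∈I : I v ≡ true
    v∈I = joins-I R I chosen v deg≤2 (λ u Iu meets → apart (u , Iu , meets))
    x₀ : Fin (m R)
    x₀ = proj₁ (proj₁ (subtree R v))
    vx₀ : F R v x₀ ≡ true
    vx₀ = proj₂ (proj₁ (subtree R v))
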